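{- Let $p$ be an odd prime. Then, modulo $p$, \[ (p-1)!!\equiv \mathrm{sf}(p-1)\equiv (-1)^{\frac{p-1}{2}}\, \mathrm{H}(p-1). \]
   Context: For a natural number $n$, the double factorial $n!!$ is the product of the natural numbers less than or equal to $n$ that have the same parity as $n$. The hyperfactorial is $\mathrm{H}(n)=\prod_{k=1}^n k^k$. The superfactorial is $\mathrm{sf}(n)=\prod_{k=1}^n k!$. -}

module Defs where

open import Data.Nat.Base using (ℕ; zero; suc; _*_; _^_; _∸_; _!)

open import Data.Integer.Base as ℤ using (ℤ; +_; _-_)
open import Data.Integer.Divisibility using (_∣_)

_!! : ℕ → ℕ
zero !! = 1
suc zero !! = 1
suc (suc n) !! = suc (suc n) * (n !!)

sf : ℕ → ℕ
sf zero = 1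
sf (suc n) = sf n * (suc n) !

H : ℕ → ℕ
H zero = 1
H (suc n) = H n * (suc n ^ suc n)

_≡_[mod_] : ℤ → ℤ → ℕ → Set
a ≡ b [mod m ] = (+ m) ∣ (a - b)

{-# OPTIONS --safe #-}
-- Write p = 2m + 1 and compute in ℤ modulo p, where p - k ≡ -k.  Since
-- sf(n) = ∏ₖ k^(n+1-k), reversing the order of the factors of sf(p-1) turns it into
-- (-1)^(1+2+⋯+(p-1)) H(p-1) = (-1)^m H(p-1).  Pairing each k ≤ m with p - k instead gives
-- sf(p-1) ≡ (-1)^(1+2+⋯+m) (m!)^p, which is (-1)^(1+2+⋯+m) m! by Fermat's little theorem.
-- On the other side (p-1)!! = 2·4⋯2m, and as in Gauss's lemma for the residue 2 the even
-- numbers above m are congruent to minus the odd numbers below it, so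
-- (p-1)!! ≡ (-1)^⌈m/2⌉ m!; finally ⌈m/2⌉ ≡ 1+2+⋯+m (mod 2).
module Submission where

open import Defs
open import Data.Nat.Base using (ℕ; _∸_; _/_)
open import Relation.Binary.PropositionalEquality using (_≢_)
open import Data.Nat.Primality using (Prime)
open import Data.Product using (_×_)
open import Data.Integer.Base using (+_; -1ℤ; _*_; _^_)

open import Level using (0ℓ)
open import Algebra.Bundles using (CommutativeSemiring; CommutativeMonoid)
open import Algebra.Structures using (IsCommutativeSemiring)
open import Data.Empty using (⊥-elim)
open import Data.Fin.Base using (Fin; zero; suc; toℕ; inject₁)
import Data.Fin.Properties as Fin
open import Data.Integer.Base using (ℤ; -_; _+_; _-_; 0ℤ; 1ℤ)
import Data.Integer.Properties as ℤ
open import Data.Integer.Divisibility.Signed as ℤ∣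
  using (_∣_; ∣ᵤ⇒∣; ∣⇒∣ᵤ; ∣m∣n⇒∣m+n; ∣m⇒∣-m; ∣m⇒∣m*n; ∣n⇒∣m*n)
open import Data.Integer.Tactic.RingSolver using (solve-∀)
open import Data.Nat.Base as ℕ using (zero; suc; _!; s≤s; z<s; NonZero)
open import Data.Nat.Combinatorics using (_C_; nCn≡1; nCk≡n!/k![n-k]!; k![n∸k]!∣n!)
open import Data.Nat.DivMod using (m/n*n≡m; m*n/n≡m)
open import Data.Nat.Divisibility as ℕ∣ using (m∣m*n; ∣1⇒≡1; ∣⇒≤) renaming (_∣_ to _∣ℕ_)
open import Data.Nat.Primality using (euclidsLemma; prime⇒nonZero; prime⇒irreducible; ¬prime[1])
import Data.Nat.Properties as ℕ
open import Data.Nat.Properties using (_!*_!≢0)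
import Data.Nat.Tactic.RingSolver as ℕ-Ring
open import Data.Product using (_,_)
open import Data.Sum using (inj₁; inj₂)
open import Data.Vec.Functional using (tail; init; last)
open import Function.Base using (_∘_)
open import Relation.Binary.PropositionalEquality
  using (_≡_; refl; sym; trans; cong; cong₂; subst; module ≡-Reasoning)
open import Relation.Binary.Structures using (IsEquivalence)
open import Relation.Nullary.Negation using (¬_)

-- A record rather than the bare divisibility, so that both sides can be inferred from a proof.
module Modulo (n : ℕ) where

  infix 4 _≈_
  record _≈_ (a b : ℤ) : Set where
    constructor mod
    field n∣a-b : + n ∣ a - b

  private
    rearrange : ∀ {x y} → x ≡ y → + n ∣ x → + n ∣ y
    rearrange = subst (+ n ∣_)

  ≡⇒≈ : ∀ {a b} → a ≡ b → a ≈ b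
  ≡⇒≈ {a} refl = mod (ℤ∣.divides 0ℤ (ℤ.+-inverseʳ a))

  ≈-refl : ∀ {a} → a ≈ a
  ≈-refl = ≡⇒≈ refl

  ≈-sym : ∀ {a b} → a ≈ b → b ≈ a
  ≈-sym {a} {b} (mod d) = mod (rearrange (lemma a b) (∣m⇒∣-m d))
    where lemma : ∀ a b → - (a - b) ≡ b - a
          lemma = solve-∀

  ≈-trans : ∀ {a b c} → a ≈ b → b ≈ c → a ≈ c
  ≈-trans {a} {b} {c} (mod d) (mod e) = mod (rearrange (lemma a b c) (∣m∣n⇒∣m+n d e))
    where lemma : ∀ a b c → (a - b) + (b - c) ≡ a - c
          lemma = solve-∀

  +-cong : ∀ {a b c d} → a ≈ b → c ≈ d → a + c ≈ b + d
  +-cong {a} {b} {c} {d} (mod e) (mod f) = mod (rearrange (lemma a b c d) (∣m∣n⇒∣m+n e f))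
    where lemma : ∀ a b c d → (a - b) + (c - d) ≡ (a + c) - (b + d)
          lemma = solve-∀

  *-cong : ∀ {a b c d} → a ≈ b → c ≈ d → a * c ≈ b * d
  *-cong {a} {b} {c} {d} (mod e) (mod f) =
    mod (rearrange (lemma a b c d) (∣m∣n⇒∣m+n (∣m⇒∣m*n c e) (∣n⇒∣m*n b f)))
    where lemma : ∀ a b c d → (a - b) * c + b * (c - d) ≡ a * c - b * d
          lemma = solve-∀

  *-congˡ : ∀ a {b c} → b ≈ c → a * b ≈ a * c
  *-congˡ a = *-cong (≈-refl {a})

  ^-cong : ∀ {a b} k → a ≈ b → a ^ k ≈ b ^ k
  ^-cong zero    _   = ≈-refl
  ^-cong (suc k) a≈b = *-cong a≈b (^-cong k a≈b)

  ∣⇒≈0 : ∀ {a} → + n ∣ a → a ≈ 0ℤ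
  ∣⇒≈0 {a} = mod ∘ rearrange (sym (ℤ.+-identityʳ a))

  ≈-complement : ∀ {a b} → a ℕ.+ b ≡ n → + b ≈ - + a
  ≈-complement {a} {b} refl =
    mod (ℤ∣.divides 1ℤ (trans (lemma (+ a) (+ b)) (sym (ℤ.*-identityˡ (+ (a ℕ.+ b))))))
    where lemma : ∀ x y → y - - x ≡ x + y
          lemma = solve-∀

  isCommutativeSemiring : IsCommutativeSemiring _≈_ _+_ _*_ 0ℤ 1ℤ
  isCommutativeSemiring = record
    { isSemiring = record
      { isSemiringWithoutAnnihilatingZero = record
        { +-isCommutativeMonoid = record
          { isMonoid = record
            { isSemigroup = record
              { isMagma = record { isEquivalence = ≈-isEquivalence ; ∙-cong = +-cong }
              ; assoc   = λ a b c → ≡⇒≈ (ℤ.+-assoc a b c)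
              }
            ; identity = (λ a → ≡⇒≈ (ℤ.+-identityˡ a)) , (λ a → ≡⇒≈ (ℤ.+-identityʳ a))
            }
          ; comm = λ a b → ≡⇒≈ (ℤ.+-comm a b)
          }
        ; *-cong     = *-cong
        ; *-assoc    = λ a b c → ≡⇒≈ (ℤ.*-assoc a b c)
        ; *-identity = (λ a → ≡⇒≈ (ℤ.*-identityˡ a)) , (λ a → ≡⇒≈ (ℤ.*-identityʳ a))
        ; distrib    = (λ a b c → ≡⇒≈ (ℤ.*-distribˡ-+ a b c)) , (λ a b c → ≡⇒≈ (ℤ.*-distribʳ-+ a b c))
        }
      ; zero = (λ a → ≡⇒≈ (ℤ.*-zeroˡ a)) , (λ a → ≡⇒≈ (ℤ.*-zeroʳ a))
      }
    ; *-comm = λ a b → ≡⇒≈ (ℤ.*-comm a b)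
    }
    where
    ≈-isEquivalence : IsEquivalence _≈_
    ≈-isEquivalence = record { refl = ≈-refl ; sym = ≈-sym ; trans = ≈-trans }

  commutativeSemiring : CommutativeSemiring 0ℓ 0ℓ
  commutativeSemiring = record { isCommutativeSemiring = isCommutativeSemiring }

  open CommutativeSemiring commutativeSemiring public using (setoid; semiring; *-commutativeMonoid)

  open import Algebra.Properties.Semiring.Binomial semiring using (binomialTerm; theorem)
  open import Algebra.Properties.Semiring.Exp semiring using () renaming (_^_ to _^ᴿ_)
  open import Algebra.Properties.Semiring.Mult semiring using () renaming (_×_ to _×ᴿ_)
  open import Algebra.Properties.Semiring.Sum semiring
    using (sum; sum-init-last; sum-cong-≋; sum-replicate-zero)
  open import Relation.Binary.Reasoning.Setoid setoid

  ^ᴿ≡^ : ∀ x k → x ^ᴿ k ≡ x ^ k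
  ^ᴿ≡^ x zero    = refl
  ^ᴿ≡^ x (suc k) = cong (x *_) (^ᴿ≡^ x k)

  ×ᴿ≈* : ∀ k z → k ×ᴿ z ≈ + k * z
  ×ᴿ≈* zero    z = ≡⇒≈ (sym (ℤ.*-zeroˡ z))
  ×ᴿ≈* (suc k) z = ≈-trans (+-cong (≈-refl {z}) (×ᴿ≈* k z)) (≡⇒≈ (sym (ℤ.suc-* (+ k) z)))

  ∣⇒×ᴿ≈0 : ∀ {k} z → n ∣ℕ k → k ×ᴿ z ≈ 0ℤ
  ∣⇒×ᴿ≈0 {k} z n∣k = ≈-trans (×ᴿ≈* k z) (∣⇒≈0 (∣m⇒∣m*n z (∣ᵤ⇒∣ {+ n} {+ k} n∣k)))

  freshman's-dream : ∀ k .{{_ : NonZero k}} → (∀ {j} → 0 ℕ.< j → j ℕ.< k → n ∣ℕ k C j) →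
                     ∀ x y → (x + y) ^ k ≈ x ^ k + y ^ k
  freshman's-dream k@(suc q) inner x y = begin
    (x + y) ^ k                                    ≡⟨ ^ᴿ≡^ (x + y) k ⟨
    (x + y) ^ᴿ k                                   ≈⟨ theorem x y (≡⇒≈ (ℤ.*-comm x y)) k ⟩
    t zero + sum (tail t)                          ≈⟨ +-cong first (sum-init-last (tail t)) ⟩
    y ^ k + (sum (init (tail t)) + last (tail t))  ≈⟨ +-cong (≈-refl {y ^ k}) (+-cong middle final) ⟩
    y ^ k + (0ℤ + x ^ k)                           ≡⟨ cong (λ z → y ^ k + z) (ℤ.+-identityˡ (x ^ k)) ⟩
    y ^ k + x ^ k                                  ≡⟨ ℤ.+-comm (y ^ k) (x ^ k) ⟩
    x ^ k + y ^ k                                  ∎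
    where
    t = binomialTerm x y k
    first : t zero ≈ y ^ k
    first = begin
      t zero                   ≈⟨ ×ᴿ≈* (k C 0) (x ^ᴿ 0 * y ^ᴿ k) ⟩
      + 1 * (1ℤ * y ^ᴿ k)      ≡⟨ trans (ℤ.*-identityˡ _) (ℤ.*-identityˡ _) ⟩
      y ^ᴿ k                   ≡⟨ ^ᴿ≡^ y k ⟩
      y ^ k                    ∎
    middle : sum (init (tail t)) ≈ 0ℤ
    middle = ≈-trans (sum-cong-≋ (λ i → ∣⇒×ᴿ≈0 _ (inner z<s (s≤s (inject₁< i))))) (sum-replicate-zero q)
      where
      inject₁< : ∀ (i : Fin q) → toℕ (inject₁ i) ℕ.< q
      inject₁< i = subst (ℕ._< q) (sym (Fin.toℕ-inject₁ i)) (Fin.toℕ<n i)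
    final : last (tail t) ≈ x ^ k
    final = begin
      last (tail t)
        ≡⟨ cong (λ j → (k C j) ×ᴿ (x ^ᴿ j * y ^ᴿ (k ∸ j))) (Fin.toℕ-fromℕ k) ⟩
      (k C k) ×ᴿ (x ^ᴿ k * y ^ᴿ (q ∸ q))
        ≡⟨ cong₂ (λ c j → c ×ᴿ (x ^ᴿ k * y ^ᴿ j)) (nCn≡1 k) (ℕ.n∸n≡0 q) ⟩
      1 ×ᴿ (x ^ᴿ k * 1ℤ)
        ≈⟨ ×ᴿ≈* 1 (x ^ᴿ k * 1ℤ) ⟩
      + 1 * (x ^ᴿ k * 1ℤ)
        ≡⟨ trans (ℤ.*-identityˡ _) (ℤ.*-identityʳ _) ⟩
      x ^ᴿ k
        ≡⟨ ^ᴿ≡^ x k ⟩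
      x ^ k ∎

infix 4 _≈_[mod_]
_≈_[mod_] : ℤ → ℤ → ℕ → Set
a ≈ b [mod n ] = Modulo._≈_ n a b

≈⇒≡[mod] : ∀ {a b n} → a ≈ b [mod n ] → a ≡ b [mod n ]
≈⇒≡[mod] a≈b = ∣⇒∣ᵤ (Modulo._≈_.n∣a-b a≈b)

-- Defined outside `Product` so that products taken in two monoids with the same carrier and
-- operation (ℤ up to equality, ℤ up to congruence) are definitionally the same.
productWith : ∀ {a} {A : Set a} → (A → A → A) → A → ℕ → (ℕ → A) → A
productWith _∙_ ε zero    f = ε
productWith _∙_ ε (suc n) f = productWith _∙_ ε n f ∙ f n

module Product {c ℓ} (M : CommutativeMonoid c ℓ) where

  open CommutativeMonoid M
    renaming (refl to ≈-refl; sym to ≈-sym; trans to ≈-trans; reflexive to ≡⇒≈)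
  open import Algebra.Properties.CommutativeSemigroup commutativeSemigroup using (interchange)
  open import Relation.Binary.Reasoning.Setoid setoid

  ∏ : ℕ → (ℕ → Carrier) → Carrier
  ∏ = productWith _∙_ ε

  ∏-cong : ∀ n {f g} → (∀ i → i ℕ.< n → f i ≈ g i) → ∏ n f ≈ ∏ n g
  ∏-cong zero    f≈g = ≈-refl
  ∏-cong (suc n) f≈g = ∙-cong (∏-cong n (λ i i<n → f≈g i (ℕ.m<n⇒m<1+n i<n))) (f≈g n (ℕ.n<1+n n))

  ∏-distrib : ∀ n (f g : ℕ → Carrier) → ∏ n (λ i → f i ∙ g i) ≈ ∏ n f ∙ ∏ n g
  ∏-distrib zero    f g = ≈-sym (identityˡ ε)
  ∏-distrib (suc n) f g = begin
    ∏ n (λ i → f i ∙ g i) ∙ (f n ∙ g n) ≈⟨ ∙-congʳ (∏-distrib n f g) ⟩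
    (∏ n f ∙ ∏ n g) ∙ (f n ∙ g n)       ≈⟨ interchange _ _ _ _ ⟩
    (∏ n f ∙ f n) ∙ (∏ n g ∙ g n)       ∎

  ∏-suc : ∀ n (f : ℕ → Carrier) → ∏ (suc n) f ≈ f 0 ∙ ∏ n (f ∘ suc)
  ∏-suc zero    f = comm ε (f 0)
  ∏-suc (suc n) f = begin
    ∏ (suc n) f ∙ f (suc n)              ≈⟨ ∙-congʳ (∏-suc n f) ⟩
    (f 0 ∙ ∏ n (f ∘ suc)) ∙ f (suc n)    ≈⟨ assoc _ _ _ ⟩
    f 0 ∙ ∏ (suc n) (f ∘ suc)            ∎

  ∏-reverse : ∀ n (f : ℕ → Carrier) → ∏ n f ≈ ∏ n (λ i → f (n ∸ suc i))
  ∏-reverse zero    f = ≈-refl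
  ∏-reverse (suc n) f = begin
    ∏ n f ∙ f n                          ≈⟨ ∙-congʳ (∏-reverse n f) ⟩
    ∏ n (λ i → f (n ∸ suc i)) ∙ f n      ≈⟨ comm _ _ ⟩
    f n ∙ ∏ n (λ i → f (n ∸ suc i))      ≈⟨ ∏-suc n (λ i → f (suc n ∸ suc i)) ⟨
    ∏ (suc n) (λ i → f (suc n ∸ suc i))  ∎

  ∏-+ : ∀ m n (f : ℕ → Carrier) → ∏ (m ℕ.+ n) f ≈ ∏ m f ∙ ∏ n (λ i → f (m ℕ.+ i))
  ∏-+ m zero    f = ≈-trans (≡⇒≈ (cong (λ k → ∏ k f) (ℕ.+-identityʳ m))) (≈-sym (identityʳ _))
  ∏-+ m (suc n) f = begin
    ∏ (m ℕ.+ suc n) f                                  ≡⟨ cong (λ k → ∏ k f) (ℕ.+-suc m n) ⟩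
    ∏ (m ℕ.+ n) f ∙ f (m ℕ.+ n)                        ≈⟨ ∙-congʳ (∏-+ m n f) ⟩
    (∏ m f ∙ ∏ n (λ i → f (m ℕ.+ i))) ∙ f (m ℕ.+ n)    ≈⟨ assoc _ _ _ ⟩
    ∏ m f ∙ ∏ (suc n) (λ i → f (m ℕ.+ i))              ∎

  ∏-pairs : ∀ m (f : ℕ → Carrier) → ∏ (m ℕ.+ m) f ≈ ∏ m (λ i → f i ∙ f (m ℕ.+ m ∸ suc i))
  ∏-pairs m f = begin
    ∏ (m ℕ.+ m) f                               ≈⟨ ∏-+ m m f ⟩
    ∏ m f ∙ ∏ m (λ i → f (m ℕ.+ i))             ≈⟨ ∙-congˡ (∏-reverse m _) ⟩
    ∏ m f ∙ ∏ m (λ i → f (m ℕ.+ (m ∸ suc i)))   ≈⟨ ∙-congˡ (∏-cong m mirror) ⟩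
    ∏ m f ∙ ∏ m (λ i → f (m ℕ.+ m ∸ suc i))     ≈⟨ ∏-distrib m f _ ⟨
    ∏ m (λ i → f i ∙ f (m ℕ.+ m ∸ suc i))       ∎
    where
    mirror : ∀ i → i ℕ.< m → f (m ℕ.+ (m ∸ suc i)) ≈ f (m ℕ.+ m ∸ suc i)
    mirror i i<m = ≡⇒≈ (cong f (sym (ℕ.+-∸-assoc m i<m)))

0^n≡0 : ∀ n .{{_ : NonZero n}} → 0ℤ ^ n ≡ 0ℤ
0^n≡0 (suc n) = refl

n∣n! : ∀ n .{{_ : NonZero n}} → n ∣ℕ n !
n∣n! (suc n) = m∣m*n (n !)

module _ {p : ℕ} (p-prime : Prime p) where

  prime∤! : ∀ {k} → k ℕ.< p → ¬ p ∣ℕ k !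
  prime∤! {zero}  _   p∣1  = ¬prime[1] (subst Prime (∣1⇒≡1 p∣1) p-prime)
  prime∤! {suc k} k<p p∣k! with euclidsLemma (suc k) (k !) p-prime p∣k!
  ... | inj₁ p∣1+k = ℕ.<⇒≱ k<p (∣⇒≤ p∣1+k)
  ... | inj₂ p∣k!′ = prime∤! (ℕ.<-trans (ℕ.n<1+n k) k<p) p∣k!′

  prime∣C : ∀ {k} → 0 ℕ.< k → k ℕ.< p → p ∣ℕ p C k
  prime∣C {k} 0<k k<p with euclidsLemma (p C k) (k ! ℕ.* (p ∸ k) !) p-prime p∣C*D
    where
    instance _ = prime⇒nonZero p-prime
    C*D≡p! : (p C k) ℕ.* (k ! ℕ.* (p ∸ k) !) ≡ p !
    C*D≡p! = trans (cong (λ c → c ℕ.* (k ! ℕ.* (p ∸ k) !)) (nCk≡n!/k![n-k]! (ℕ.<⇒≤ k<p)))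
                   (m/n*n≡m {{k !* (p ∸ k) !≢0}} (k![n∸k]!∣n! (ℕ.<⇒≤ k<p)))
    p∣C*D : p ∣ℕ (p C k) ℕ.* (k ! ℕ.* (p ∸ k) !)
    p∣C*D = subst (p ∣ℕ_) (sym C*D≡p!) (n∣n! p)
  ... | inj₁ p∣C = p∣C
  ... | inj₂ p∣D with euclidsLemma (k !) ((p ∸ k) !) p-prime p∣D
  ...   | inj₁ p∣k!     = ⊥-elim (prime∤! k<p p∣k!)
  ...   | inj₂ p∣[p-k]! = ⊥-elim (prime∤! (ℕ.∸-monoʳ-< 0<k (ℕ.<⇒≤ k<p)) p∣[p-k]!)

  open Modulo p
  open import Relation.Binary.Reasoning.Setoid setoid

  private instance
    p≢0 : NonZero p
    p≢0 = prime⇒nonZero p-prime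

  fermat : ∀ a → (+ a) ^ p ≈ + a
  fermat zero    = ≡⇒≈ (0^n≡0 p)
  fermat (suc a) = begin
    (1ℤ + + a) ^ p       ≈⟨ freshman's-dream p prime∣C 1ℤ (+ a) ⟩
    1ℤ ^ p + (+ a) ^ p   ≈⟨ +-cong (≡⇒≈ (ℤ.^-zeroˡ p)) (fermat a) ⟩
    1ℤ + + a             ∎

module ℤ∏ = Product ℤ.*-1-commutativeMonoid
open ℤ∏ using (∏)

^-distribʳ-* : ∀ a b n → (a * b) ^ n ≡ a ^ n * b ^ n
^-distribʳ-* a b zero    = refl
^-distribʳ-* a b (suc n) = trans (cong ((a * b) *_) (^-distribʳ-* a b n)) (interchange a b (a ^ n) (b ^ n))
  where interchange : ∀ a b c d → a * b * (c * d) ≡ a * c * (b * d)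
        interchange = solve-∀

pos-^ : ∀ a n → + (a ℕ.^ n) ≡ (+ a) ^ n
pos-^ a zero    = refl
pos-^ a (suc n) = trans (ℤ.pos-* a (a ℕ.^ n)) (cong (+ a *_) (pos-^ a n))

∏-const : ∀ n x → ∏ n (λ _ → x) ≡ x ^ n
∏-const zero    x = refl
∏-const (suc n) x = trans (cong (_* x) (∏-const n x)) (ℤ.*-comm (x ^ n) x)

-1^[n+n]≡1 : ∀ n → -1ℤ ^ (n ℕ.+ n) ≡ 1ℤ
-1^[n+n]≡1 n = trans (ℤ.^-distribˡ-+-* -1ℤ n n) (square≡1 n)
  where square≡1 : ∀ n → -1ℤ ^ n * -1ℤ ^ n ≡ 1ℤ
        square≡1 zero    = refl
        square≡1 (suc n) = trans (lemma (-1ℤ ^ n)) (square≡1 n)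
          where lemma : ∀ s → (-1ℤ * s) * (-1ℤ * s) ≡ s * s
                lemma = solve-∀

σ : ℕ → ℤ
σ n = ∏ n (λ i → -1ℤ ^ suc i)

σ-even : ∀ a → σ (a ℕ.+ a) ≡ -1ℤ ^ a
σ-odd  : ∀ a → σ (suc (a ℕ.+ a)) ≡ -1ℤ ^ suc a

σ-even zero    = refl
σ-even (suc a) = begin
  σ (suc a ℕ.+ suc a)                            ≡⟨ cong (σ ∘ suc) (ℕ.+-suc a a) ⟩
  σ (suc (a ℕ.+ a)) * -1ℤ ^ suc (suc (a ℕ.+ a))  ≡⟨ cong₂ (λ s e → s * (-1ℤ * (-1ℤ * e))) (σ-odd a) (-1^[n+n]≡1 a) ⟩
  -1ℤ ^ suc a * (-1ℤ * (-1ℤ * 1ℤ))               ≡⟨ ℤ.*-identityʳ _ ⟩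
  -1ℤ ^ suc a                                    ∎
  where open ≡-Reasoning
σ-odd a = begin
  σ (a ℕ.+ a) * -1ℤ ^ suc (a ℕ.+ a)   ≡⟨ cong₂ (λ s e → s * (-1ℤ * e)) (σ-even a) (-1^[n+n]≡1 a) ⟩
  -1ℤ ^ a * (-1ℤ * 1ℤ)                ≡⟨ ℤ.*-comm (-1ℤ ^ a) -1ℤ ⟩
  -1ℤ ^ suc a                         ∎
  where open ≡-Reasoning

!≡∏ : ∀ n → + (n !) ≡ ∏ n (λ i → + suc i)
!≡∏ zero    = refl
!≡∏ (suc n) = trans (ℤ.pos-* (suc n) (n !)) (trans (ℤ.*-comm (+ suc n) (+ (n !))) (cong (_* + suc n) (!≡∏ n)))

H≡∏ : ∀ n → + H n ≡ ∏ n (λ i → (+ suc i) ^ suc i)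
H≡∏ zero    = refl
H≡∏ (suc n) = trans (ℤ.pos-* (H n) (suc n ℕ.^ suc n)) (cong₂ _*_ (H≡∏ n) (pos-^ (suc n) (suc n)))

sf≡∏ : ∀ n → + sf n ≡ ∏ n (λ i → (+ suc i) ^ (n ∸ i))
sf≡∏ zero    = refl
sf≡∏ (suc n) = begin
  + (sf n ℕ.* suc n !)                         ≡⟨ ℤ.pos-* (sf n) (suc n !) ⟩
  + sf n * + (suc n !)                         ≡⟨ cong₂ _*_ (sf≡∏ n) (!≡∏ (suc n)) ⟩
  ∏ n f * (∏ n v * v n)                        ≡⟨ ℤ.*-assoc (∏ n f) (∏ n v) (v n) ⟨
  ∏ n f * ∏ n v * v n                          ≡⟨ cong (_* v n) (ℤ∏.∏-distrib n f v) ⟨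
  ∏ n (λ i → f i * v i) * v n                  ≡⟨ cong₂ _*_ (ℤ∏.∏-cong n raise) (sym (ℤ.^-identityʳ (v n))) ⟩
  ∏ n (λ i → v i ^ (suc n ∸ i)) * v n ^ 1      ≡⟨ cong (λ k → ∏ n (λ i → v i ^ (suc n ∸ i)) * v n ^ k) (ℕ.m+n∸n≡m 1 n) ⟨
  ∏ (suc n) (λ i → v i ^ (suc n ∸ i))          ∎
  where
  open ≡-Reasoning
  v f : ℕ → ℤ
  v i = + suc i
  f i = v i ^ (n ∸ i)
  raise : ∀ i → i ℕ.< n → f i * v i ≡ v i ^ (suc n ∸ i)
  raise i i<n = trans (ℤ.*-comm (f i) (v i)) (cong (v i ^_) (sym (ℕ.+-∸-assoc 1 (ℕ.<⇒≤ i<n))))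

evenℤ oddℤ : ℕ → ℤ
evenℤ i = + suc (suc (i ℕ.+ i))
oddℤ  i = + suc (i ℕ.+ i)

!!≡∏ : ∀ m → + ((m ℕ.+ m) !!) ≡ ∏ m evenℤ
!!≡∏ zero    = refl
!!≡∏ (suc m) = begin
  + (suc (m ℕ.+ suc m) !!)                   ≡⟨ cong (λ k → + (suc k !!)) (ℕ.+-suc m m) ⟩
  + (suc (suc (m ℕ.+ m)) ℕ.* (m ℕ.+ m) !!)   ≡⟨ ℤ.pos-* (suc (suc (m ℕ.+ m))) ((m ℕ.+ m) !!) ⟩
  evenℤ m * + ((m ℕ.+ m) !!)                 ≡⟨ cong (evenℤ m *_) (!!≡∏ m) ⟩
  evenℤ m * ∏ m evenℤ                        ≡⟨ ℤ.*-comm (evenℤ m) (∏ m evenℤ) ⟩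
  ∏ (suc m) evenℤ                            ∎
  where open ≡-Reasoning

[a+a]!≡evens*odds   : ∀ a → + ((a ℕ.+ a) !) ≡ ∏ a evenℤ * ∏ a oddℤ
[1+a+a]!≡evens*odds : ∀ a → + (suc (a ℕ.+ a) !) ≡ ∏ a evenℤ * ∏ (suc a) oddℤ

[a+a]!≡evens*odds zero    = refl
[a+a]!≡evens*odds (suc a) = begin
  + ((suc a ℕ.+ suc a) !)                  ≡⟨ cong (λ k → + (suc k !)) (ℕ.+-suc a a) ⟩
  + (suc (suc (a ℕ.+ a)) !)                ≡⟨ ℤ.pos-* (suc (suc (a ℕ.+ a))) (suc (a ℕ.+ a) !) ⟩
  evenℤ a * + (suc (a ℕ.+ a) !)            ≡⟨ cong (evenℤ a *_) ([1+a+a]!≡evens*odds a) ⟩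
  evenℤ a * (∏ a evenℤ * ∏ (suc a) oddℤ)   ≡⟨ ℤ.*-assoc (evenℤ a) (∏ a evenℤ) (∏ (suc a) oddℤ) ⟨
  evenℤ a * ∏ a evenℤ * ∏ (suc a) oddℤ     ≡⟨ cong (_* ∏ (suc a) oddℤ) (ℤ.*-comm (evenℤ a) (∏ a evenℤ)) ⟩
  ∏ (suc a) evenℤ * ∏ (suc a) oddℤ         ∎
  where open ≡-Reasoning
[1+a+a]!≡evens*odds a = begin
  + (suc (a ℕ.+ a) !)                      ≡⟨ ℤ.pos-* (suc (a ℕ.+ a)) ((a ℕ.+ a) !) ⟩
  oddℤ a * + ((a ℕ.+ a) !)                 ≡⟨ cong (oddℤ a *_) ([a+a]!≡evens*odds a) ⟩
  oddℤ a * (∏ a evenℤ * ∏ a oddℤ)          ≡⟨ lemma (oddℤ a) (∏ a evenℤ) (∏ a oddℤ) ⟩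
  ∏ a evenℤ * ∏ (suc a) oddℤ               ∎
  where
  open ≡-Reasoning
  lemma : ∀ x e o → x * (e * o) ≡ e * (o * x)
  lemma = solve-∀

-- The last b even numbers 2(a+b-i) below p are congruent to minus the first b odd numbers 2i+1.
gauss : ∀ {m} a b → a ℕ.+ b ≡ m →
        ∏ m evenℤ ≈ -1ℤ ^ b * (∏ a evenℤ * ∏ b oddℤ) [mod suc (m ℕ.+ m) ]
gauss a b refl = begin
  ∏ (a ℕ.+ b) evenℤ                                  ≈⟨ ∏-+ a b evenℤ ⟩
  ∏ a evenℤ * ∏ b (λ i → evenℤ (a ℕ.+ i))            ≈⟨ *-congˡ (∏ a evenℤ) (∏-reverse b _) ⟩
  ∏ a evenℤ * ∏ b (λ i → evenℤ (a ℕ.+ (b ∸ suc i)))  ≈⟨ *-congˡ (∏ a evenℤ) (∏-cong b reflect) ⟩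
  ∏ a evenℤ * ∏ b (λ i → -1ℤ * oddℤ i)               ≈⟨ *-congˡ (∏ a evenℤ) (∏-distrib b _ oddℤ) ⟩
  ∏ a evenℤ * (∏ b (λ _ → -1ℤ) * ∏ b oddℤ)           ≡⟨ cong (λ s → ∏ a evenℤ * (s * ∏ b oddℤ)) (∏-const b -1ℤ) ⟩
  ∏ a evenℤ * (-1ℤ ^ b * ∏ b oddℤ)                   ≈⟨ x∙yz≈y∙xz (∏ a evenℤ) (-1ℤ ^ b) (∏ b oddℤ) ⟩
  -1ℤ ^ b * (∏ a evenℤ * ∏ b oddℤ)                   ∎
  where
  open Modulo (suc ((a ℕ.+ b) ℕ.+ (a ℕ.+ b)))
  open Product *-commutativeMonoid using (∏-+; ∏-reverse; ∏-cong; ∏-distrib)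
  open import Algebra.Properties.CommutativeSemigroup
    (CommutativeMonoid.commutativeSemigroup *-commutativeMonoid) using (x∙yz≈y∙xz)
  open import Relation.Binary.Reasoning.Setoid setoid
  reflect : ∀ i → i ℕ.< b → evenℤ (a ℕ.+ (b ∸ suc i)) ≈ -1ℤ * oddℤ i
  reflect i i<b = ≈-trans (≈-complement sum≡p) (≡⇒≈ (sym (ℤ.-1*i≡-i (oddℤ i))))
    where
    d = b ∸ suc i
    arrange : ∀ a d i → suc (i ℕ.+ i) ℕ.+ suc (suc ((a ℕ.+ d) ℕ.+ (a ℕ.+ d)))
                      ≡ suc ((a ℕ.+ (d ℕ.+ suc i)) ℕ.+ (a ℕ.+ (d ℕ.+ suc i)))
    arrange = ℕ-Ring.solve-∀
    sum≡p : suc (i ℕ.+ i) ℕ.+ suc (suc ((a ℕ.+ d) ℕ.+ (a ℕ.+ d))) ≡ suc ((a ℕ.+ b) ℕ.+ (a ℕ.+ b))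
    sum≡p = trans (arrange a d i) (cong (λ k → suc ((a ℕ.+ k) ℕ.+ (a ℕ.+ k))) (ℕ.m∸n+n≡m i<b))

data Parity : ℕ → Set where
  even : ∀ a → Parity (a ℕ.+ a)
  odd  : ∀ a → Parity (suc (a ℕ.+ a))

parity : ∀ n → Parity n
parity zero = even 0
parity (suc n) with parity n
... | even a = odd a
... | odd a  = subst Parity (ℕ.+-suc (suc a) a) (even (suc a))

!!≈σ*! : ∀ m → + ((m ℕ.+ m) !!) ≈ σ m * + (m !) [mod suc (m ℕ.+ m) ]
!!≈σ*! m with parity m
... | even a = begin
  + ((m ℕ.+ m) !!)                             ≡⟨ !!≡∏ m ⟩
  ∏ m evenℤ                                    ≈⟨ gauss a a refl ⟩
  -1ℤ ^ a * (∏ a evenℤ * ∏ a oddℤ)             ≡⟨ cong₂ _*_ (σ-even a) ([a+a]!≡evens*odds a) ⟨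
  σ m * + (m !)                                ∎
  where
  open Modulo (suc (m ℕ.+ m))
  open import Relation.Binary.Reasoning.Setoid setoid
... | odd a = begin
  + ((m ℕ.+ m) !!)                             ≡⟨ !!≡∏ m ⟩
  ∏ m evenℤ                                    ≈⟨ gauss a (suc a) (ℕ.+-suc a a) ⟩
  -1ℤ ^ suc a * (∏ a evenℤ * ∏ (suc a) oddℤ)   ≡⟨ cong₂ _*_ (σ-odd a) ([1+a+a]!≡evens*odds a) ⟨
  σ m * + (m !)                                ∎
  where
  open Modulo (suc (m ℕ.+ m))
  open import Relation.Binary.Reasoning.Setoid setoid

mirror≈ : ∀ {N i} → i ℕ.< N → + suc (N ∸ suc i) ≈ -1ℤ * + suc i [mod suc N ]
mirror≈ {N} {i} i<N = ≈-trans (≈-complement sum≡1+N) (≡⇒≈ (sym (ℤ.-1*i≡-i (+ suc i))))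
  where
  open Modulo (suc N)
  sum≡1+N : suc i ℕ.+ suc (N ∸ suc i) ≡ suc N
  sum≡1+N = trans (ℕ.+-suc (suc i) (N ∸ suc i)) (cong suc (ℕ.m+[n∸m]≡n i<N))

sf≈σ*H : ∀ N → + sf N ≈ σ N * + H N [mod suc N ]
sf≈σ*H N = begin
  + sf N                                          ≡⟨ sf≡∏ N ⟩
  ∏ N (λ i → v i ^ (N ∸ i))                       ≈⟨ ∏-reverse N _ ⟩
  ∏ N (λ i → v (N ∸ suc i) ^ (N ∸ (N ∸ suc i)))   ≈⟨ ∏-cong N reflect ⟩
  ∏ N (λ i → -1ℤ ^ suc i * v i ^ suc i)           ≈⟨ ∏-distrib N _ _ ⟩
  σ N * ∏ N (λ i → v i ^ suc i)                   ≡⟨ cong (σ N *_) (H≡∏ N) ⟨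
  σ N * + H N                                     ∎
  where
  open Modulo (suc N)
  open Product *-commutativeMonoid using (∏-reverse; ∏-cong; ∏-distrib)
  open import Relation.Binary.Reasoning.Setoid setoid
  v : ℕ → ℤ
  v i = + suc i
  reflect : ∀ i → i ℕ.< N → v (N ∸ suc i) ^ (N ∸ (N ∸ suc i)) ≈ -1ℤ ^ suc i * v i ^ suc i
  reflect i i<N = begin
    v (N ∸ suc i) ^ (N ∸ (N ∸ suc i))   ≡⟨ cong (v (N ∸ suc i) ^_) (ℕ.m∸[m∸n]≡n i<N) ⟩
    v (N ∸ suc i) ^ suc i               ≈⟨ ^-cong (suc i) (mirror≈ i<N) ⟩
    (-1ℤ * v i) ^ suc i                 ≡⟨ ^-distribʳ-* -1ℤ (v i) (suc i) ⟩
    -1ℤ ^ suc i * v i ^ suc i           ∎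

sf≈σ*! : ∀ m → Prime (suc (m ℕ.+ m)) → + sf (m ℕ.+ m) ≈ σ m * + (m !) [mod suc (m ℕ.+ m) ]
sf≈σ*! m p-prime = begin
  + sf N                              ≡⟨ sf≡∏ N ⟩
  ∏ N f                               ≈⟨ ∏-pairs m f ⟩
  ∏ m (λ i → f i * f (N ∸ suc i))     ≈⟨ ∏-cong m pair ⟩
  ∏ m (λ i → -1ℤ ^ suc i * v i)       ≈⟨ ∏-distrib m _ _ ⟩
  σ m * ∏ m v                         ≡⟨ cong (σ m *_) (!≡∏ m) ⟨
  σ m * + (m !)                       ∎
  where
  N = m ℕ.+ m
  open Modulo (suc N)
  open Product *-commutativeMonoid using (∏-pairs; ∏-cong; ∏-distrib)
  open import Algebra.Properties.CommutativeSemigroup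
    (CommutativeMonoid.commutativeSemigroup *-commutativeMonoid) using (x∙yz≈y∙xz)
  open import Relation.Binary.Reasoning.Setoid setoid
  v f : ℕ → ℤ
  v i = + suc i
  f i = v i ^ (N ∸ i)
  pair : ∀ i → i ℕ.< m → f i * f (N ∸ suc i) ≈ -1ℤ ^ suc i * v i
  pair i i<m = begin
    f i * v j ^ (N ∸ j)                       ≡⟨ cong (λ e → f i * v j ^ e) (ℕ.m∸[m∸n]≡n i<N) ⟩
    f i * v j ^ suc i                         ≈⟨ *-congˡ (f i) (^-cong (suc i) (mirror≈ i<N)) ⟩
    f i * (-1ℤ * v i) ^ suc i                 ≡⟨ cong (f i *_) (^-distribʳ-* -1ℤ (v i) (suc i)) ⟩
    f i * (-1ℤ ^ suc i * v i ^ suc i)         ≈⟨ x∙yz≈y∙xz (f i) (-1ℤ ^ suc i) (v i ^ suc i) ⟩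
    -1ℤ ^ suc i * (f i * v i ^ suc i)         ≡⟨ cong (-1ℤ ^ suc i *_) (ℤ.^-distribˡ-+-* (v i) (N ∸ i) (suc i)) ⟨
    -1ℤ ^ suc i * v i ^ (N ∸ i ℕ.+ suc i)     ≡⟨ cong (λ e → -1ℤ ^ suc i * v i ^ e) exponent ⟩
    -1ℤ ^ suc i * v i ^ suc N                 ≈⟨ *-congˡ (-1ℤ ^ suc i) (fermat p-prime (suc i)) ⟩
    -1ℤ ^ suc i * v i                         ∎
    where
    j = N ∸ suc i
    i<N = ℕ.<-≤-trans i<m (ℕ.m≤m+n m m)
    exponent : N ∸ i ℕ.+ suc i ≡ suc N
    exponent = trans (ℕ.+-suc (N ∸ i) i) (cong suc (ℕ.m∸n+n≡m (ℕ.<⇒≤ i<N)))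

m+m≡m*2 : ∀ m → m ℕ.+ m ≡ m ℕ.* 2
m+m≡m*2 m = trans (cong (m ℕ.+_) (sym (ℕ.+-identityʳ m))) (ℕ.*-comm 2 m)

[m+m]/2≡m : ∀ m → (m ℕ.+ m) / 2 ≡ m
[m+m]/2≡m m = trans (cong (_/ 2) (m+m≡m*2 m)) (m*n/n≡m m 2)

even-prime≡2 : ∀ a → Prime (a ℕ.+ a) → a ℕ.+ a ≡ 2
even-prime≡2 a p-prime with prime⇒irreducible p-prime (ℕ∣.divides a (m+m≡m*2 a))
... | inj₂ 2≡a+a = sym 2≡a+a

theorem1p2 : (p : ℕ) → Prime p → p ≢ 2 →
    ((+ ((p ∸ 1) !!)) ≡ (+ sf (p ∸ 1)) [mod p ]) ×
    ((+ sf (p ∸ 1)) ≡ ((-1ℤ ^ ((p ∸ 1) / 2)) * (+ H (p ∸ 1))) [mod p ])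
theorem1p2 p p-prime p≢2 with parity p
... | even a = ⊥-elim (p≢2 (even-prime≡2 a p-prime))
... | odd m  = ≈⇒≡[mod] !!≈sf , ≈⇒≡[mod] sf≈±H
  where
  N = m ℕ.+ m
  open Modulo (suc N)
  !!≈sf : + (N !!) ≈ + sf N
  !!≈sf = ≈-trans (!!≈σ*! m) (≈-sym (sf≈σ*! m p-prime))
  sf≈±H : + sf N ≈ -1ℤ ^ (N / 2) * + H N
  sf≈±H rewrite [m+m]/2≡m m = ≈-trans (sf≈σ*H N) (≡⇒≈ (cong (_* + H N) (σ-even m)))
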